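{- Let $$\begin{array}{ccc} A' & \xrightarrow{v} & A\\ {\scriptstyle f'}\downarrow & & \downarrow{\scriptstyle f}\\ B' & \xrightarrow{w} & B\end{array}$$ be a pullback square in a category with pullbacks, such that $w$ and $f$ are regular epimorphisms and $v$ and $f'$ are split epimorphisms. Then the square is also a pushout.
   Context: A regular epimorphism is a morphism that is a coequalizer of some pair of morphisms. A split epimorphism is a morphism $g$ having a section $s$ with $g\circ s=\mathrm{id}$. -}

module Defs where

open import Level using (Level; suc; _⊔_)
open import Relation.Binary using (Rel; IsEquivalence)
open import Data.Product using (Σ; Σ-syntax; _×_; _,_)

record Category (o ℓ e : Level) : Set (suc (o ⊔ ℓ ⊔ e)) where
  infixr 9 _∘_
  infix  4 _≈_
  field
    Obj    : Set o
    Hom    : Obj → Obj → Set ℓ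
    _≈_    : ∀ {A B} → Rel (Hom A B) e
    id     : ∀ {A} → Hom A A
    _∘_    : ∀ {A B C} → Hom B C → Hom A B → Hom A C
    ≈-equiv : ∀ {A B} → IsEquivalence (_≈_ {A} {B})
    ∘-resp-≈ : ∀ {A B C} {f g : Hom B C} {h i : Hom A B} →
               f ≈ g → h ≈ i → f ∘ h ≈ g ∘ i
    assoc  : ∀ {A B C D} {f : Hom A B} {g : Hom B C} {h : Hom C D} →
             (h ∘ g) ∘ f ≈ h ∘ (g ∘ f)
    identityˡ : ∀ {A B} {f : Hom A B} → id ∘ f ≈ f
    identityʳ : ∀ {A B} {f : Hom A B} → f ∘ id ≈ f

module _ {o ℓ e : Level} (𝒞 : Category o ℓ e) where
  open Category 𝒞

  IsCoequalizer : ∀ {X Y Z} → Hom X Y → Hom X Y → Hom Y Z → Set (o ⊔ ℓ ⊔ e)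
  IsCoequalizer {X} {Y} {Z} g h q =
    (q ∘ g ≈ q ∘ h) ×
    (∀ {W} (k : Hom Y W) → k ∘ g ≈ k ∘ h →
       Σ[ u ∈ Hom Z W ] ((u ∘ q ≈ k) ×
         (∀ (u' : Hom Z W) → u' ∘ q ≈ k → u' ≈ u)))

  RegularEpi : ∀ {Y Z} → Hom Y Z → Set (o ⊔ ℓ ⊔ e)
  RegularEpi {Y} {Z} q =
    Σ[ X ∈ Obj ] Σ[ g ∈ Hom X Y ] Σ[ h ∈ Hom X Y ] IsCoequalizer g h q

  SplitEpi : ∀ {Y Z} → Hom Y Z → Set (ℓ ⊔ e)
  SplitEpi {Y} {Z} g = Σ[ s ∈ Hom Z Y ] (g ∘ s ≈ id)

  IsPullback : ∀ {P A B C} (p₁ : Hom P A) (p₂ : Hom P B)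
               (f : Hom A C) (g : Hom B C) → Set (o ⊔ ℓ ⊔ e)
  IsPullback {P} {A} {B} {C} p₁ p₂ f g =
    (f ∘ p₁ ≈ g ∘ p₂) ×
    (∀ {X} (h₁ : Hom X A) (h₂ : Hom X B) → f ∘ h₁ ≈ g ∘ h₂ →
       Σ[ u ∈ Hom X P ] ((p₁ ∘ u ≈ h₁) × (p₂ ∘ u ≈ h₂) ×
         (∀ (u' : Hom X P) → p₁ ∘ u' ≈ h₁ → p₂ ∘ u' ≈ h₂ → u' ≈ u)))

  IsPushout : ∀ {C A B Q} (f : Hom C A) (g : Hom C B)
              (i₁ : Hom A Q) (i₂ : Hom B Q) → Set (o ⊔ ℓ ⊔ e)
  IsPushout {C} {A} {B} {Q} f g i₁ i₂ =
    (i₁ ∘ f ≈ i₂ ∘ g) ×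
    (∀ {X} (h₁ : Hom A X) (h₂ : Hom B X) → h₁ ∘ f ≈ h₂ ∘ g →
       Σ[ u ∈ Hom Q X ] ((u ∘ i₁ ≈ h₁) × (u ∘ i₂ ≈ h₂) ×
         (∀ (u' : Hom Q X) → u' ∘ i₁ ≈ h₁ → u' ∘ i₂ ≈ h₂ → u' ≈ u)))

  HasPullbacks : Set (o ⊔ ℓ ⊔ e)
  HasPullbacks = ∀ {A B C} (f : Hom A C) (g : Hom B C) →
    Σ[ P ∈ Obj ] Σ[ p₁ ∈ Hom P A ] Σ[ p₂ ∈ Hom P B ] IsPullback p₁ p₂ f g

-- Let h₁ : B' → X and h₂ : A → X satisfy h₁ f' ≈ h₂ v. For any a : L → A
-- the section s of v turns f a into w (f' s a), and the pullback then forces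
-- h₂ a ≈ h₁ (f' s a). Hence h₂ takes the same value on any pair that f
-- coequalizes, so it factors as u f through the regular epi f; and
-- u w f' ≈ u f v ≈ h₁ f' gives u w ≈ h₁ because f' is split.
module Submission where

open import Level using (Level)
open import Data.Product using (Σ-syntax; _×_; _,_)
open import Relation.Binary using (Setoid; IsEquivalence)
import Relation.Binary.Reasoning.Setoid as SetoidReasoning
open import Defs

module CategoryReasoning {o ℓ e : Level} (𝒞 : Category o ℓ e) where
  open Category 𝒞

  module ≈ {X Y : Obj} = IsEquivalence (≈-equiv {X} {Y})

  hom-setoid : Obj → Obj → Setoid ℓ e
  hom-setoid X Y = record { isEquivalence = ≈-equiv {X} {Y} }

  module HomReasoning {X Y : Obj} = SetoidReasoning (hom-setoid X Y)

  ∘-resp-≈ˡ : ∀ {X Y Z} {g h : Hom Y Z} {k : Hom X Y} → g ≈ h → g ∘ k ≈ h ∘ k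
  ∘-resp-≈ˡ p = ∘-resp-≈ p ≈.refl

  ∘-resp-≈ʳ : ∀ {X Y Z} {g : Hom Y Z} {h k : Hom X Y} → h ≈ k → g ∘ h ≈ g ∘ k
  ∘-resp-≈ʳ p = ∘-resp-≈ ≈.refl p

  square-extendʳ : ∀ {W X Y Y' Z} {a : Hom Y Z} {b : Hom X Y} {c : Hom Y' Z}
                   {d : Hom X Y'} (k : Hom W X) →
                   a ∘ b ≈ c ∘ d → a ∘ (b ∘ k) ≈ c ∘ (d ∘ k)
  square-extendʳ {a = a} {b} {c} {d} k p = begin
    a ∘ (b ∘ k) ≈⟨ ≈.sym assoc ⟩
    (a ∘ b) ∘ k ≈⟨ ∘-resp-≈ˡ p ⟩
    (c ∘ d) ∘ k ≈⟨ assoc ⟩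
    c ∘ (d ∘ k) ∎
    where open HomReasoning

module _ {o ℓ e : Level} (𝒞 : Category o ℓ e) where
  open Category 𝒞
  open CategoryReasoning 𝒞
  open HomReasoning

  split-epi-cancelʳ : ∀ {X Y Z} {g : Hom X Y} {s : Hom Y X} {a b : Hom Y Z} →
                      g ∘ s ≈ id → a ∘ g ≈ b ∘ g → a ≈ b
  split-epi-cancelʳ {g = g} {s} {a} {b} gs≈id ag≈bg = begin
    a           ≈⟨ ≈.sym identityʳ ⟩
    a ∘ id      ≈⟨ ∘-resp-≈ʳ (≈.sym gs≈id) ⟩
    a ∘ (g ∘ s) ≈⟨ square-extendʳ s ag≈bg ⟩
    b ∘ (g ∘ s) ≈⟨ ∘-resp-≈ʳ gs≈id ⟩
    b ∘ id      ≈⟨ identityʳ ⟩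
    b           ∎

  section-lifts-to-cone : ∀ {L P A B C} {p₁ : Hom P A} {p₂ : Hom P B}
                          {f : Hom A C} {g : Hom B C} {s : Hom A P} →
                          f ∘ p₁ ≈ g ∘ p₂ → p₁ ∘ s ≈ id →
                          (a : Hom L A) → f ∘ a ≈ g ∘ (p₂ ∘ (s ∘ a))
  section-lifts-to-cone {p₁ = p₁} {p₂} {f} {g} {s} sq p₁s≈id a = begin
    f ∘ a               ≈⟨ ∘-resp-≈ʳ (≈.sym identityˡ) ⟩
    f ∘ (id ∘ a)        ≈⟨ ∘-resp-≈ʳ (∘-resp-≈ˡ (≈.sym p₁s≈id)) ⟩
    f ∘ ((p₁ ∘ s) ∘ a)  ≈⟨ ∘-resp-≈ʳ assoc ⟩
    f ∘ (p₁ ∘ (s ∘ a))  ≈⟨ square-extendʳ (s ∘ a) sq ⟩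
    g ∘ (p₂ ∘ (s ∘ a))  ∎

  cocone-respects-pullback : ∀ {L P A B C X} {p₁ : Hom P A} {p₂ : Hom P B}
                             {f : Hom A C} {g : Hom B C} {h₁ : Hom A X} {h₂ : Hom B X} →
                             IsPullback 𝒞 p₁ p₂ f g → h₁ ∘ p₁ ≈ h₂ ∘ p₂ →
                             {a : Hom L A} {b : Hom L B} → f ∘ a ≈ g ∘ b → h₁ ∘ a ≈ h₂ ∘ b
  cocone-respects-pullback {p₁ = p₁} {p₂} {h₁ = h₁} {h₂} (_ , universal) cocone {a} {b} cone
    with universal a b cone
  ... | m , p₁m≈a , p₂m≈b , _ = begin
    h₁ ∘ a        ≈⟨ ∘-resp-≈ʳ (≈.sym p₁m≈a) ⟩
    h₁ ∘ (p₁ ∘ m) ≈⟨ square-extendʳ m cocone ⟩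
    h₂ ∘ (p₂ ∘ m) ≈⟨ ∘-resp-≈ʳ p₂m≈b ⟩
    h₂ ∘ b        ∎

lemmaA2 : ∀ {o ℓ e : Level} (𝒞 : Category o ℓ e) → HasPullbacks 𝒞 →
    ∀ {A' A B' B : Category.Obj 𝒞}
      (v : Category.Hom 𝒞 A' A) (f' : Category.Hom 𝒞 A' B')
      (f : Category.Hom 𝒞 A B) (w : Category.Hom 𝒞 B' B) →
    IsPullback 𝒞 v f' f w →
    RegularEpi 𝒞 w → RegularEpi 𝒞 f →
    SplitEpi 𝒞 v → SplitEpi 𝒞 f' →
    IsPushout 𝒞 f' v w f
lemmaA2 𝒞 _ v f' f w pullback@(sq , _) _ (_ , g , h , (fg≈fh , factor)) (s , vs≈id) (t , f't≈id) =
  ≈.sym sq , copair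
  where
  open Category 𝒞
  open CategoryReasoning 𝒞

  copair : ∀ {X} (h₁ : Hom _ X) (h₂ : Hom _ X) → h₁ ∘ f' ≈ h₂ ∘ v →
           Σ[ u ∈ Hom _ X ] ((u ∘ w ≈ h₁) × (u ∘ f ≈ h₂) ×
             (∀ u' → u' ∘ w ≈ h₁ → u' ∘ f ≈ h₂ → u' ≈ u))
  copair h₁ h₂ cocone with factor h₂ h₂-coequalizes
    where
    h₂-respects : ∀ {L} {a : Hom L _} {b : Hom L _} → f ∘ a ≈ w ∘ b → h₂ ∘ a ≈ h₁ ∘ b
    h₂-respects = cocone-respects-pullback 𝒞 pullback (≈.sym cocone)
    fg-cone : f ∘ g ≈ w ∘ (f' ∘ (s ∘ g))
    fg-cone = section-lifts-to-cone 𝒞 sq vs≈id g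
    h₂-coequalizes : h₂ ∘ g ≈ h₂ ∘ h
    h₂-coequalizes = ≈.trans (h₂-respects fg-cone)
                             (≈.sym (h₂-respects (≈.trans (≈.sym fg≈fh) fg-cone)))
  ... | u , uf≈h₂ , unique =
    u , split-epi-cancelʳ 𝒞 f't≈id uwf'≈h₁f' , uf≈h₂ , λ u' _ u'f≈h₂ → unique u' u'f≈h₂
    where
    uwf'≈h₁f' : (u ∘ w) ∘ f' ≈ h₁ ∘ f'
    uwf'≈h₁f' = begin
      (u ∘ w) ∘ f' ≈⟨ assoc ⟩
      u ∘ (w ∘ f') ≈⟨ ∘-resp-≈ʳ (≈.sym sq) ⟩
      u ∘ (f ∘ v)  ≈⟨ ≈.sym assoc ⟩
      (u ∘ f) ∘ v  ≈⟨ ∘-resp-≈ˡ uf≈h₂ ⟩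
      h₂ ∘ v       ≈⟨ ≈.sym cocone ⟩
      h₁ ∘ f'      ∎
      where open HomReasoning
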